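{- For every deterministic treasure hunt algorithm $\mathcal{A}$, every $K\in\mathcal{T}_{\mathrm{comp}}^{\mathrm{nodist}}$ and every integer $m\ge1$, $$\mathcal{O}_{\mathcal{A}}^{K}(m)\ \ge\ \max_{(T,d)\in B_m(K)}\frac{L_1^d(T)}{d}.$$
   Context: Treasure hunt in trees. A tree is a finite tree rooted at the starting node of a mobile agent; at each node of degree $\delta$ the incident edges carry port numbers $0,\dots,\delta-1$. $h(T)$ is the depth of $T$. $l_i(T)$ is the number of nodes at distance $i$ from the root and $L_a^b(T)=\sum_{i=a}^b l_i(T)$. An instance is a pair $(T,d)$ with $T$ a tree and $1\le d\le h(T)$. $\mathcal{T}_{\mathrm{comp}}^{\mathrm{nodist}}$ is the family of all knowledges $K=\{(T^*,d):1\le d\le h(T^*)\}$, $T^*$ a tree (complete map, unknown distance). A deterministic algorithm given $K$ starts at the root; at each step it sees the port numbers at its current node, chooses one based on its history (initially $K$), traverses the edge and learns the entry port and degree of the new node. The cost $C_{\mathcal{A}}^K(T,d)$ is the number of edge traversals (including revisits) made by $\mathcal{A}$ in $T$ until all nodes at distance exactly $d$ from the root have been visited. $B_m(K)=\{(T,d)\in K:d\le m\}$ and the overhead is $\mathcal{O}_{\mathcal{A}}^K(m)=\max_{(T,d)\in B_m(K)}C_{\mathcal{A}}^K(T,d)/d$ if $B_m(K)\ne\emptyset$, and $0$ otherwise. -}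

module Defs where

open import Data.Nat using (ℕ; zero; suc; _+_; _*_; _∸_; _⊔_; _≤_; _<_; _<?_; _≟_)
open import Data.Nat.Properties using (<-cmp)
open import Data.Fin using (Fin; toℕ; fromℕ<)
open import Data.List using (List; []; _∷_; reverse; length; foldr; tabulate)
open import Data.Nat.ListAction using (sum)
open import Data.Maybe using (Maybe; just; nothing; Is-just)
open import Data.Product using (Σ; ∃; ∃-syntax; _×_; _,_)
open import Relation.Nullary using (yes; no)
open import Relation.Binary using (tri<; tri≈; tri>)
open import Relation.Binary.PropositionalEquality using (_≡_)

-- The children are listed in increasing order
-- of their port numbers at this node.  The Fin (suc k) value p is, for a
-- NON-root node, the port number (among 0..k) of the edge to its parent;
-- the remaining ports 0..k (except p) lead to the children in order.
-- At the root the value p is ignored: the root has degree k and port j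
-- leads to child j.  Every port-labelled tree rooted at the start node is
-- represented (up to isomorphism) this way.

data Tree : Set where
  node : (k : ℕ) → Fin (suc k) → (Fin k → Tree) → Tree

-- nodes are addressed by the sequence of child indices from the root
Address : Set
Address = List ℕ

subtree : Tree → Address → Maybe Tree
subtree t [] = just t
subtree (node k p ch) (i ∷ a) with i <? k
... | yes i<k = subtree (ch (fromℕ< i<k)) a
... | no _    = nothing

level : Tree → ℕ → ℕ
level (node k p ch) zero    = 1
level (node k p ch) (suc i) = sum (tabulate {n = k} (λ j → level (ch j) i))

L1 : ℕ → Tree → ℕ
L1 zero    T = 0
L1 (suc d) T = L1 d T + level T (suc d)

height : Tree → ℕ
height (node zero p ch)    = 0
height (node (suc k) p ch) = suc (foldr _⊔_ 0 (tabulate {n = suc k} (λ j → height (ch j))))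

-- degree of a node (given its reversed address)
deg : Tree → List ℕ → ℕ
deg (node k p ch) []      = k
deg (node k p ch) (_ ∷ _) = suc k

childPort : Tree → List ℕ → ℕ → ℕ
childPort (node k p ch) []      i = i
childPort (node k p ch) (_ ∷ _) i with i <? toℕ p
... | yes _ = i
... | no _  = suc i

parentPort : Tree → ℕ
parentPort (node k p ch) = toℕ p

data Dir : Set where
  up   : Dir
  down : ℕ → Dir

decode : Tree → List ℕ → ℕ → Maybe Dir
decode (node k p ch) [] j with j <? k
... | yes _ = just (down j)
... | no _  = nothing
decode (node k p ch) (_ ∷ _) j with j <? suc k
... | no _ = nothing
... | yes _ with <-cmp j (toℕ p)
...   | tri< _ _ _ = just (down j)
...   | tri≈ _ _ _ = just up
...   | tri> _ _ _ = just (down (j ∸ 1))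

-- One edge traversal.  Position = reversed address (head = last step).
-- Result: new position, entry port at the new node, degree of new node.
move : Tree → List ℕ → ℕ → Maybe (List ℕ × ℕ × ℕ)
move T r j with subtree T (reverse r)
... | nothing = nothing
... | just v with decode v r j
...   | nothing = nothing
...   | just (down c) with subtree T (reverse (c ∷ r))
...     | nothing = nothing
...     | just w  = just (c ∷ r , parentPort w , deg w (c ∷ r))
move T r j | just v | just up with r
...     | [] = nothing
...     | i ∷ r' with subtree T (reverse r')
...       | nothing = nothing
...       | just u  = just (r' , childPort u r' i , deg u r')

-- What the agent has observed: the degree of the start node, then for
-- each traversal the port taken, the entry port and the degree of the
-- node reached.
data History : Set where
  start : ℕ → History
  step  : History → ℕ → ℕ → ℕ → History

currentDeg : History → ℕ
currentDeg (start δ)       = δ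
currentDeg (step _ _ _ δ)  = δ

-- The knowledge K = {(T*,d) : 1 ≤ d ≤ h(T*)} ∈ T_comp^nodist is
-- determined by the map T*, so it is given to the algorithm as T*.
-- Based on K and its history, the algorithm picks a port of the current
-- node, or stops (nothing).
Algorithm : Set
Algorithm = Tree → (h : History) → Maybe (Fin (currentDeg h))

rootDeg : Tree → ℕ
rootDeg T = deg T []

-- state after t edge traversals of A (with knowledge K) in T; nothing if
-- the agent has stopped before making t traversals
run : Algorithm → Tree → Tree → ℕ → Maybe (List ℕ × History)
run A K T zero = just ([] , start (rootDeg T))
run A K T (suc t) with run A K T t
... | nothing = nothing
... | just (r , h) with A K h
...   | nothing = nothing
...   | just j with move T r (toℕ j)
...     | nothing = nothing
...     | just (r' , e , δ) = just (r' , step h (toℕ j) e δ)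

Covers : Algorithm → Tree → Tree → ℕ → ℕ → Set
Covers A K T d t =
  Is-just (run A K T t) ×
  ((a : Address) → length a ≡ d → Is-just (subtree T a) →
     ∃[ s ] ∃[ h ] (s ≤ t × run A K T s ≡ just (reverse a , h)))

{-# OPTIONS --safe #-}
-- Let L = L_1^d(T), so that T has L + 1 nodes of depth at most d.  During its
-- first L steps (times 0, …, L − 1) the agent occupies at most L of them, so some
-- node v of depth d' ≤ d is first reached at time ≥ L; v is not the root, which
-- is occupied at time 0, so d' ≥ 1.  Exploring level d' of T costs at least L
-- traversals, and L · d' ≤ L · d ≤ cost · d.
module Submission where

open import Defs
open import Data.Nat using (ℕ; _*_; _≤_)
open import Data.Product using (∃-syntax; _×_)

open import Data.Nat using (zero; suc; _+_; _<_; _<?_; _≟_; z≤n; s≤s)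
open import Data.Nat.Properties
  using (+-suc; +-mono-≤; *-mono-≤; n<1+n; ≤-trans; <⇒≱; m≤n⇒m≤1+n; ≮⇒≥; +-commutativeSemigroup)
open import Data.Nat.ListAction using (sum)
open import Data.Fin using (Fin; toℕ) renaming (zero to fzero; suc to fsuc)
open import Data.Fin.Properties using (toℕ<n; fromℕ<-toℕ)
open import Data.List using (List; []; _∷_; reverse; length; tabulate; applyUpTo)
open import Data.List.Properties using (≡-dec; reverse-involutive; length-applyUpTo)
open import Data.List.Relation.Unary.Any using (here; there)
open import Data.List.Membership.DecPropositional (≡-dec _≟_) using (_∈_; _∉_; _∈?_)
open import Data.List.Membership.Propositional.Properties using (∈-applyUpTo⁺)
open import Data.Maybe using (just; nothing; Is-just)
open import Data.Maybe.Relation.Unary.Any using () renaming (just to is-just)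
open import Data.Product using (_,_)
open import Data.Sum using (_⊎_; inj₁; inj₂)
open import Relation.Nullary using (yes; no; contradiction)
open import Relation.Binary.PropositionalEquality using (_≡_; refl; cong; subst; sym)
open import Function using (_∘_)
open import Algebra.Properties.CommutativeSemigroup +-commutativeSemigroup using (interchange)

L0 : ℕ → Tree → ℕ
L0 zero    T = level T 0
L0 (suc d) T = L0 d T + level T (suc d)

L0≡1+L1 : ∀ d T → L0 d T ≡ suc (L1 d T)
L0≡1+L1 zero    (node k p ch) = refl
L0≡1+L1 (suc d) T             = cong (_+ level T (suc d)) (L0≡1+L1 d T)

sum-tabulate-+ : ∀ k (f g : Fin k → ℕ) →
  sum (tabulate (λ j → f j + g j)) ≡ sum (tabulate f) + sum (tabulate g)
sum-tabulate-+ zero    f g = refl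
sum-tabulate-+ (suc k) f g rewrite sum-tabulate-+ k (f ∘ fsuc) (g ∘ fsuc) =
  interchange (f fzero) (g fzero) _ _

L0-node : ∀ d k p (ch : Fin k → Tree) →
  L0 (suc d) (node k p ch) ≡ suc (sum (tabulate (λ j → L0 d (ch j))))
L0-node zero    k p ch = refl
L0-node (suc d) k p ch rewrite L0-node d k p ch =
  cong suc (sym (sum-tabulate-+ k (λ j → L0 d (ch j)) (λ j → level (ch j) (suc d))))

-- Addresses inside the first child's subtree, and inside the later children's
-- subtrees renumbered so that these children form a forest indexed from 0.
underFirst : List Address → List Address
underFirst []                = []
underFirst ((zero ∷ a) ∷ S)  = a ∷ underFirst S
underFirst (_ ∷ S)           = underFirst S

underRest : List Address → List Address
underRest []                 = []
underRest ((suc i ∷ a) ∷ S)  = (i ∷ a) ∷ underRest S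
underRest (_ ∷ S)            = underRest S

∈-underFirst : ∀ {a S} → (0 ∷ a) ∈ S → a ∈ underFirst S
∈-underFirst {S = (zero ∷ _) ∷ _}  (here refl) = here refl
∈-underFirst {S = [] ∷ _}          (there p)   = ∈-underFirst p
∈-underFirst {S = (zero ∷ _) ∷ _}  (there p)   = there (∈-underFirst p)
∈-underFirst {S = (suc _ ∷ _) ∷ _} (there p)   = ∈-underFirst p

∈-underRest : ∀ {i a S} → (suc i ∷ a) ∈ S → (i ∷ a) ∈ underRest S
∈-underRest {S = (suc _ ∷ _) ∷ _} (here refl) = here refl
∈-underRest {S = [] ∷ _}          (there p)   = ∈-underRest p
∈-underRest {S = (zero ∷ _) ∷ _}  (there p)   = ∈-underRest p
∈-underRest {S = (suc _ ∷ _) ∷ _} (there p)   = there (∈-underRest p)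

length-split≤ : ∀ S → length (underFirst S) + length (underRest S) ≤ length S
length-split≤ []                = z≤n
length-split≤ ([] ∷ S)          = m≤n⇒m≤1+n (length-split≤ S)
length-split≤ ((zero ∷ _) ∷ S)  = s≤s (length-split≤ S)
length-split≤ ((suc _ ∷ _) ∷ S)
  rewrite +-suc (length (underFirst S)) (length (underRest S)) =
  s≤s (length-split≤ S)

length-split<-∋root : ∀ {S} → [] ∈ S →
  length (underFirst S) + length (underRest S) < length S
length-split<-∋root {[] ∷ S}          _         = s≤s (length-split≤ S)
length-split<-∋root {(zero ∷ _) ∷ S}  (there p) = s≤s (length-split<-∋root p)
length-split<-∋root {(suc _ ∷ _) ∷ S} (there p)
  rewrite +-suc (length (underFirst S)) (length (underRest S)) =
  s≤s (length-split<-∋root p)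

Missing : Tree → ℕ → List Address → Set
Missing T d S = ∃[ a ] (length a ≤ d × Is-just (subtree T a) × a ∉ S)

MissingInForest : ∀ {k} → (Fin k → Tree) → ℕ → List Address → Set
MissingInForest ch d S =
  ∃[ j ] ∃[ a ] (length a ≤ d × Is-just (subtree (ch j) a) × (toℕ j ∷ a) ∉ S)

subtree-child : ∀ {k p} (ch : Fin k → Tree) j a → Is-just (subtree (ch j) a) →
  Is-just (subtree (node k p ch) (toℕ j ∷ a))
subtree-child {k} ch j a a∈ch with toℕ j <? k
... | yes j<k = subst (λ c → Is-just (subtree (ch c) a)) (sym (fromℕ<-toℕ j j<k)) a∈ch
... | no  j≮k = contradiction (toℕ<n j) j≮k

mutual
  missing⊎L0≤length : ∀ d T S → Missing T d S ⊎ L0 d T ≤ length S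
  missing⊎L0≤length d (node k p ch) S with [] ∈? S
  ... | no []∉S = inj₁ ([] , z≤n , is-just _ , []∉S)
  missing⊎L0≤length zero (node k p ch) (_ ∷ _) | yes _ = inj₂ (s≤s z≤n)
  missing⊎L0≤length (suc d) (node k p ch) S | yes []∈S
    with forest-missing⊎sum-L0≤length d k ch S
  ... | inj₁ (j , a , |a|≤d , a∈ch , j∷a∉S) =
    inj₁ (toℕ j ∷ a , s≤s |a|≤d , subtree-child {p = p} ch j a a∈ch , j∷a∉S)
  ... | inj₂ sum≤ = inj₂ (subst (_≤ length S) (sym (L0-node d k p ch))
                              (≤-trans (s≤s sum≤) (length-split<-∋root []∈S)))

  forest-missing⊎sum-L0≤length : ∀ d k (ch : Fin k → Tree) S →
    MissingInForest ch d S ⊎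
    sum (tabulate (λ j → L0 d (ch j))) ≤ length (underFirst S) + length (underRest S)
  forest-missing⊎sum-L0≤length d zero    ch S = inj₂ z≤n
  forest-missing⊎sum-L0≤length d (suc k) ch S with missing⊎L0≤length d (ch fzero) (underFirst S)
  ... | inj₁ (a , |a|≤d , a∈ch , a∉) =
    inj₁ (fzero , a , |a|≤d , a∈ch , λ 0∷a∈S → a∉ (∈-underFirst 0∷a∈S))
  ... | inj₂ first≤ with forest-missing⊎sum-L0≤length d k (λ j → ch (fsuc j)) (underRest S)
  ...   | inj₁ (j , a , |a|≤d , a∈ch , j∷a∉) =
    inj₁ (fsuc j , a , |a|≤d , a∈ch , λ sj∷a∈S → j∷a∉ (∈-underRest sj∷a∈S))
  ...   | inj₂ rest≤ = inj₂ (+-mono-≤ first≤ (≤-trans rest≤ (length-split≤ (underRest S))))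

length<L0⇒missing : ∀ d T S → length S < L0 d T → Missing T d S
length<L0⇒missing d T S |S|<L0 with missing⊎L0≤length d T S
... | inj₁ missing = missing
... | inj₂ L0≤|S|  = contradiction L0≤|S| (<⇒≱ |S|<L0)

position : Algorithm → Tree → ℕ → Address
position A T s with run A T T s
... | just (r , _) = reverse r
... | nothing      = []

visited : Algorithm → Tree → ℕ → List Address
visited A T n = applyUpTo (position A T) n

position-run : ∀ A T s a {h} → run A T T s ≡ just (reverse a , h) → position A T s ≡ a
position-run A T s a eq rewrite eq = reverse-involutive a

first-visit≥ : ∀ A T n {a s h} → a ∉ visited A T n →
  run A T T s ≡ just (reverse a , h) → n ≤ s
first-visit≥ A T n {a} {s} a∉ eq with s <? n
... | yes s<n = contradiction
  (subst (_∈ visited A T n) (position-run A T s a eq) (∈-applyUpTo⁺ (position A T) s<n)) a∉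
... | no  s≮n = ≮⇒≥ s≮n

covering-cost≥ : ∀ A T n {a} → a ∉ visited A T n → Is-just (subtree T a) →
  ∀ t → Covers A T T (length a) t → n ≤ t
covering-cost≥ A T n {a} a∉ a∈T t (_ , covers) with covers a refl a∈T
... | s , _ , s≤t , eq = ≤-trans (first-visit≥ A T n a∉ eq) s≤t

lemma2p3 : (A : Algorithm) (Tstar : Tree) (m : ℕ) → 1 ≤ m →
    (d : ℕ) → 1 ≤ d → d ≤ height Tstar → d ≤ m →
    ∃[ d' ] (1 ≤ d' × d' ≤ height Tstar × d' ≤ m ×
      ((t : ℕ) → Covers A Tstar Tstar d' t → L1 d Tstar * d' ≤ t * d))
lemma2p3 A T m _ d 1≤d d≤h d≤m with L1 d T in L1≡
... | zero  = d , 1≤d , d≤h , d≤m , λ _ _ → z≤n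
... | suc L with length<L0⇒missing d T (visited A T (suc L)) |visited|<L0
  where
  |visited|<L0 : length (visited A T (suc L)) < L0 d T
  |visited|<L0 rewrite length-applyUpTo (position A T) (suc L) | L0≡1+L1 d T | L1≡ =
    n<1+n (suc L)
...   | []        , _ , _ , root∉ = contradiction (here refl) root∉
...   | a@(_ ∷ _) , |a|≤d , a∈T , a∉ =
  length a , s≤s z≤n , ≤-trans |a|≤d d≤h , ≤-trans |a|≤d d≤m ,
  λ t covers → *-mono-≤ (covering-cost≥ A T (suc L) a∉ a∈T t covers) |a|≤d
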